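{- Let $\mathcal{M}$ be a $4$-divisible multiset of points in $\mathrm{PG}(v-1,2)$ with cardinality $10$. Then either there exists a point $P$ with $\mathcal{M}(P)\ge4$, or $\mathcal{M}=2\cdot\chi_{B_5}$ where $B_5$ is a projective base of size $5$.
   Context: $\mathrm{PG}(v-1,2)$ is the projective geometry of $\mathbb{F}_2^v$; points and hyperplanes are subspaces of dimension $1$ and $v-1$. A multiset of points $\mathcal{M}$ assigns to each point $P$ a multiplicity $\mathcal{M}(P)\in\{0,1,2,\dots\}$; $\mathcal{M}(K)=\sum_{P\le K}\mathcal{M}(P)$ for a subspace $K$, and $\#\mathcal{M}=\mathcal{M}(\mathbb{F}_2^v)$. $\mathcal{M}$ is $\Delta$-divisible if $\mathcal{M}(H)\equiv\#\mathcal{M}\pmod\Delta$ for every hyperplane $H$. For a set of points $B$, $\chi_B$ has multiplicity $1$ on the points of $B$ and $0$ elsewhere. A projective base of size $n$ is a set of $n$ points such that any $n-1$ of them span an $(n-1)$-dimensional subspace. -}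

module Defs where

open import Data.Bool using (Bool; true; false; _∧_; _∨_; _xor_; not; T; if_then_else_)
open import Data.Nat using (ℕ; zero; suc; _+_; _*_)
open import Data.Vec using (Vec; []; _∷_; removeAt; zipWith; replicate; foldr)
open import Data.List using (List; []; _∷_; map; _++_)
open import Data.Nat.ListAction using (sum)
open import Data.Integer using (ℤ; +_; _-_)
open import Data.Integer.Divisibility using (_∣_)
open import Data.Fin using (Fin)
open import Data.Unit using (tt)
import Data.Vec

-- Vectors of F₂^v are Vec Bool v (true = 1, false = 0; addition = xor, multiplication = ∧).

nz : ∀ {v} → Vec Bool v → Bool
nz []       = false
nz (b ∷ x) = b ∨ nz x

-- Points of PG(v-1,2): one-dimensional subspaces of F₂^v, i.e. nonzero vectors
-- (over F₂ each 1-dim subspace has exactly one nonzero vector).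
record Point (v : ℕ) : Set where
  constructor point
  field
    vec     : Vec Bool v
    nonzero : T (nz vec)
open Point public

Multiset : ℕ → Set
Multiset v = Point v → ℕ

allVecs : (v : ℕ) → List (Vec Bool v)
allVecs zero    = [] ∷ []
allVecs (suc v) = map (false ∷_) (allVecs v) ++ map (true ∷_) (allVecs v)

ext' : (b : Bool) → (T b → ℕ) → ℕ
ext' true  f = f tt
ext' false f = 0

ext : ∀ {v} → Multiset v → Vec Bool v → ℕ
ext M x = ext' (nz x) (λ t → M (point x t))

_⊕_ : ∀ {v} → Vec Bool v → Vec Bool v → Vec Bool v
_⊕_ = zipWith _xor_

dot : ∀ {v} → Vec Bool v → Vec Bool v → Bool
dot a x = foldr (λ _ → Bool) _xor_ false (zipWith _∧_ a x)

card : ∀ {v} → Multiset v → ℕ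
card {v} M = sum (map (ext M) (allVecs v))

-- Hyperplanes of PG(v-1,2) are exactly the kernels H_a = {x | a·x = 0} of
-- nonzero linear functionals a; M(H_a) = Σ_{P ≤ H_a} M(P).
hypMult : ∀ {v} → Multiset v → Point v → ℕ
hypMult {v} M a =
  sum (map (λ x → if dot (vec a) x then 0 else ext M x) (allVecs v))

_≡_[mod_] : ℕ → ℕ → ℕ → Set
m ≡ n [mod d ] = (+ d) ∣ ((+ m) - (+ n))

Divisible : ∀ {v} → (Δ : ℕ) → Multiset v → Set
Divisible {v} Δ M = (a : Point v) → hypMult M a ≡ card M [mod Δ ]

lincomb : ∀ {v k} → Vec Bool k → Vec (Vec Bool v) k → Vec Bool v
lincomb {v} []       []       = replicate v false
lincomb     (c ∷ cs) (x ∷ xs) = (if c then x else replicate _ false) ⊕ lincomb cs xs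

LinIndep : ∀ {v k} → Vec (Vec Bool v) k → Set
LinIndep xs = ∀ c → T (nz c) → T (nz (lincomb c xs))

vecs : ∀ {v k} → Vec (Point v) k → Vec (Vec Bool v) k
vecs = Data.Vec.map vec

-- Projective base of size n+1 (listed as a vector of points): any n of them span an
-- n-dimensional subspace, i.e. any n of them are linearly independent.
ProjectiveBase : ∀ {v n} → Vec (Point v) (suc n) → Set
ProjectiveBase B = ∀ (i : Fin _) → LinIndep (vecs (removeAt B i))

beq : ∀ {v} → Vec Bool v → Vec Bool v → Bool
beq []       []       = true
beq (a ∷ x) (b ∷ y) = not (a xor b) ∧ beq x y

χ : ∀ {v k} → Vec (Point v) k → Multiset v
χ []       P = 0
χ (Q ∷ B) P = if beq (vec Q) (vec P) then 1 else χ B P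

-- Let m be the multiplicity function on F₂^v and W(a) = Σ_{a·x = 1} m(x) the weight off the
-- hyperplane a·x = 0; the hypotheses say 4 ∣ W(a) for every functional a.  Since
-- W(a) + W(b) = W(a ⊕ b) + 2·m{a·x = b·x = 1}, every cell cut out by two functionals has even
-- weight, hence an even number of points of odd multiplicity.  Separating two odd points by a
-- functional shows that a half-space containing an odd point contains at least four, and the
-- whole space at least eight.  As 10 = #odd points + 2·Σ ⌊m/2⌋, that leaves either no point of
-- multiplicity ≥ 2, excluded by averaging W over all a (the mean is 5, but every W(a) ≤ 4), or a
-- single one, excluded because it forces a half-space with exactly two odd points.  So all
-- multiplicities are even.  If none reaches 4 then M = 2·χ_B for a set B of five points, and
-- 4 ∣ W(a) = 2·#{b ∈ B : a·b = 1} says that B sums to zero.  Five distinct nonzero vectors with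
-- zero sum form a projective base: a relation among four of them, or its complement (again a
-- relation, because of the zero sum), involves at most two vectors.

module Submission where

open import Defs
open import Data.Bool using (Bool; true; false; not; _∧_; _xor_; T; if_then_else_)
open import Data.Bool.Properties
  using ( xor-∧-commutativeRing; ∧-distribʳ-xor; ∧-distribˡ-xor; xor-identityʳ; xor-same
        ; ∧-comm; ∧-zeroʳ; not-involutive; if-eta )
open import Data.Nat using (ℕ; zero; suc; _+_; _*_; _∸_; _^_; _≤_; _<_; z≤n; s≤s; _≤?_; _%_; _/_)
open import Data.Nat.Properties
open import Data.Nat.DivMod using (m≡m%n+[m/n]*n; m%n<n; /-monoˡ-≤)
open import Data.Nat.Divisibility
  using (_∣_; divides; ∣m+n∣m⇒∣n; ∣m∣n⇒∣m+n; ∣-trans; m∣m*n; *-cancelˡ-∣; ∣1⇒≡1)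
open import Data.Nat.ListAction using (sum)
open import Data.Nat.ListAction.Properties using (sum-++)
import Data.Integer as ℤ
open import Data.Integer.Properties using ([+m]-[+n]≡m⊖n; ∣⊖∣-≤)
open import Data.List as List using (List; []; _∷_; _++_)
open import Data.List.Properties using (map-++; map-∘; map-cong)
open import Data.Fin using (Fin; zero; suc)
open import Data.Vec using (Vec; []; _∷_; replicate; removeAt; insertAt; map)
open import Data.Vec.Properties using (zipWith-identityˡ; zipWith-identityʳ)
open import Data.Vec.Relation.Unary.All as All using (All; []; _∷_)
open import Data.Vec.Relation.Unary.Any using (here; there)
open import Data.Vec.Relation.Unary.AllPairs using ([]; _∷_)
open import Data.Vec.Relation.Unary.Unique.Propositional using (Unique)
open import Data.Vec.Membership.Propositional using (_∈_)
open import Data.Product using (∃; _×_; _,_; proj₁; proj₂)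
open import Data.Sum using (_⊎_; inj₁; inj₂; [_,_]′)
open import Data.Unit using (tt)
open import Data.Empty using (⊥; ⊥-elim)
open import Function using (_∘_)
open import Relation.Nullary using (yes; no)
open import Relation.Binary.PropositionalEquality
open import Algebra.Bundles using (CommutativeRing)
open import Algebra.Properties.CommutativeSemigroup +-commutativeSemigroup
  using () renaming (interchange to +-interchange)
open import Algebra.Properties.CommutativeSemigroup
  (CommutativeRing.+-commutativeSemigroup xor-∧-commutativeRing)
  using () renaming (interchange to xor-interchange)

private
  variable
    A B : Set
    v n : ℕ

sum-map-+ : (xs : List A) (f g : A → ℕ) →
            sum (List.map (λ x → f x + g x) xs) ≡ sum (List.map f xs) + sum (List.map g xs)
sum-map-+ []       f g = refl
sum-map-+ (x ∷ xs) f g =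
  trans (cong (f x + g x +_) (sum-map-+ xs f g)) (+-interchange (f x) (g x) _ _)

sum-map-*ˡ : (xs : List A) (k : ℕ) (f : A → ℕ) →
             sum (List.map (λ x → k * f x) xs) ≡ k * sum (List.map f xs)
sum-map-*ˡ []       k f = sym (*-zeroʳ k)
sum-map-*ˡ (x ∷ xs) k f =
  trans (cong (k * f x +_) (sum-map-*ˡ xs k f)) (sym (*-distribˡ-+ k (f x) _))

sum-map-mono : (xs : List A) {f g : A → ℕ} → (∀ x → f x ≤ g x) →
               sum (List.map f xs) ≤ sum (List.map g xs)
sum-map-mono []       f≤g = z≤n
sum-map-mono (x ∷ xs) f≤g = +-mono-≤ (f≤g x) (sum-map-mono xs f≤g)

sum-map-0 : (xs : List A) → sum (List.map (λ _ → 0) xs) ≡ 0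
sum-map-0 []       = refl
sum-map-0 (_ ∷ xs) = sum-map-0 xs

sum-map-swap : (xs : List A) (ys : List B) (f : A → B → ℕ) →
               sum (List.map (λ x → sum (List.map (f x) ys)) xs) ≡
               sum (List.map (λ y → sum (List.map (λ x → f x y) xs)) ys)
sum-map-swap []       ys f = sym (sum-map-0 ys)
sum-map-swap (x ∷ xs) ys f =
  trans (cong (sum (List.map (f x) ys) +_) (sum-map-swap xs ys f))
        (sym (sum-map-+ ys (f x) (λ y → sum (List.map (λ x → f x y) xs))))

-- Opaque, so that unification sees ∑ f rather than a list sum over allVecs v, from which v
-- cannot be recovered.
opaque
  ∑ : (Vec Bool v → ℕ) → ℕ
  ∑ {v} f = sum (List.map f (allVecs v))

opaque
  unfolding ∑

  ∑-cong : {f g : Vec Bool v → ℕ} → (∀ x → f x ≡ g x) → ∑ f ≡ ∑ g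
  ∑-cong {v} f≗g = cong sum (map-cong f≗g (allVecs v))

  ∑-+ : (f g : Vec Bool v → ℕ) → ∑ (λ x → f x + g x) ≡ ∑ f + ∑ g
  ∑-+ {v} = sum-map-+ (allVecs v)

  ∑-*ˡ : (k : ℕ) (f : Vec Bool v → ℕ) → ∑ (λ x → k * f x) ≡ k * ∑ f
  ∑-*ˡ {v} = sum-map-*ˡ (allVecs v)

  ∑-mono : {f g : Vec Bool v → ℕ} → (∀ x → f x ≤ g x) → ∑ f ≤ ∑ g
  ∑-mono {v} = sum-map-mono (allVecs v)

  ∑-swap : (f : Vec Bool v → Vec Bool v → ℕ) → ∑ (λ a → ∑ (f a)) ≡ ∑ (λ x → ∑ (λ a → f a x))
  ∑-swap {v} = sum-map-swap (allVecs v) (allVecs v)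

  ∑-split : (f : Vec Bool (suc v) → ℕ) → ∑ f ≡ ∑ (f ∘ (false ∷_)) + ∑ (f ∘ (true ∷_))
  ∑-split {v} f = begin
    sum (List.map f (L₀ ++ L₁))               ≡⟨ cong sum (map-++ f L₀ L₁) ⟩
    sum (List.map f L₀ ++ List.map f L₁)      ≡⟨ sum-++ (List.map f L₀) _ ⟩
    sum (List.map f L₀) + sum (List.map f L₁) ≡⟨ cong₂ _+_ (cong sum (sym (map-∘ (allVecs v))))
                                                            (cong sum (sym (map-∘ (allVecs v)))) ⟩
    ∑ (f ∘ (false ∷_)) + ∑ (f ∘ (true ∷_))    ∎
    where
    open ≡-Reasoning
    L₀ L₁ : List (Vec Bool (suc v))
    L₀ = List.map (false ∷_) (allVecs v)
    L₁ = List.map (true ∷_) (allVecs v)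

  ∑-zero : {f : Vec Bool v → ℕ} → (∀ x → f x ≡ 0) → ∑ f ≡ 0
  ∑-zero {v} f≗0 = trans (∑-cong f≗0) (sum-map-0 (allVecs v))

  term≤∑ : (f : Vec Bool v → ℕ) (x : Vec Bool v) → f x ≤ ∑ f
  term≤∑ f [] = m≤m+n (f []) 0
  term≤∑ f (false ∷ x) rewrite ∑-split f = ≤-trans (term≤∑ (f ∘ (false ∷_)) x) (m≤m+n _ _)
  term≤∑ f (true  ∷ x) rewrite ∑-split f = ≤-trans (term≤∑ (f ∘ (true ∷_)) x) (m≤n+m _ _)

  ∑-pos : (f : Vec Bool v → ℕ) → 0 < ∑ f → ∃ λ x → 0 < f x
  ∑-pos {v} f = go (allVecs v)
    where
    go : (xs : List (Vec Bool v)) → 0 < sum (List.map f xs) → ∃ λ x → 0 < f x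
    go (x ∷ xs) 0<Σ with f x in fx≡
    ... | zero  = go xs 0<Σ
    ... | suc _ = x , subst (0 <_) (sym fx≡) (s≤s z≤n)

  ∑-const : ∀ v → ∑ {v} (λ _ → 1) ≡ 2 ^ v
  ∑-const zero    = refl
  ∑-const (suc v) rewrite ∑-split {v} (λ _ → 1) | ∑-const v = cong (2 ^ v +_) (sym (+-identityʳ (2 ^ v)))

  ∑-δ : (y : Vec Bool v) (f : Vec Bool v → ℕ) → (∀ x → beq y x ≡ false → f x ≡ 0) → ∑ f ≡ f y
  ∑-δ []          f _   = +-identityʳ (f [])
  ∑-δ (false ∷ y) f off rewrite ∑-split f
    | ∑-δ y (f ∘ (false ∷_)) (λ x → off (false ∷ x)) | ∑-zero (λ x → off (true ∷ x) refl) = +-identityʳ _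
  ∑-δ (true ∷ y)  f off rewrite ∑-split f
    | ∑-δ y (f ∘ (true ∷_)) (λ x → off (true ∷ x)) | ∑-zero (λ x → off (false ∷ x) refl) = refl

𝟎 : Vec Bool v
𝟎 = replicate _ false

beq-refl : (x : Vec Bool v) → beq x x ≡ true
beq-refl []          = refl
beq-refl (true  ∷ x) = beq-refl x
beq-refl (false ∷ x) = beq-refl x

beq-sound : (x y : Vec Bool v) → beq x y ≡ true → x ≡ y
beq-sound []          []          _  = refl
beq-sound (true  ∷ x) (true  ∷ y) eq = cong (true ∷_) (beq-sound x y eq)
beq-sound (false ∷ x) (false ∷ y) eq = cong (false ∷_) (beq-sound x y eq)

beq≡false⇒≢ : (x y : Vec Bool v) → beq x y ≡ false → x ≢ y
beq≡false⇒≢ x .x eq refl with () ← trans (sym eq) (beq-refl x)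

nz≡false⇒≡𝟎 : (x : Vec Bool v) → nz x ≡ false → x ≡ 𝟎
nz≡false⇒≡𝟎 []          _  = refl
nz≡false⇒≡𝟎 (false ∷ x) eq = cong (false ∷_) (nz≡false⇒≡𝟎 x eq)

⊕-identityˡ : (x : Vec Bool v) → 𝟎 ⊕ x ≡ x
⊕-identityˡ = zipWith-identityˡ (λ _ → refl)

⊕-identityʳ : (x : Vec Bool v) → x ⊕ 𝟎 ≡ x
⊕-identityʳ = zipWith-identityʳ xor-identityʳ

dot-𝟎ˡ : (x : Vec Bool v) → dot 𝟎 x ≡ false
dot-𝟎ˡ []      = refl
dot-𝟎ˡ (_ ∷ x) = dot-𝟎ˡ x

dot-𝟎ʳ : (a : Vec Bool v) → dot a 𝟎 ≡ false
dot-𝟎ʳ []          = refl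
dot-𝟎ʳ (true  ∷ a) = dot-𝟎ʳ a
dot-𝟎ʳ (false ∷ a) = dot-𝟎ʳ a

dot-⊕ˡ : (a b x : Vec Bool v) → dot (a ⊕ b) x ≡ dot a x xor dot b x
dot-⊕ˡ []      []      []      = refl
dot-⊕ˡ (p ∷ a) (q ∷ b) (y ∷ x) rewrite dot-⊕ˡ a b x | ∧-distribʳ-xor y p q =
  xor-interchange (p ∧ y) (q ∧ y) (dot a x) (dot b x)

dot-⊕ʳ : (a x y : Vec Bool v) → dot a (x ⊕ y) ≡ dot a x xor dot a y
dot-⊕ʳ []      []      []      = refl
dot-⊕ʳ (p ∷ a) (q ∷ x) (r ∷ y) rewrite dot-⊕ʳ a x y | ∧-distribˡ-xor p q r =
  xor-interchange (p ∧ q) (p ∧ r) (dot a x) (dot a y)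

nonzero⇒detected : (x : Vec Bool v) → nz x ≡ true → ∃ λ a → dot a x ≡ true
nonzero⇒detected (true ∷ x)  _  = (true ∷ 𝟎) , cong not (dot-𝟎ˡ x)
nonzero⇒detected (false ∷ x) nz with nonzero⇒detected x nz
... | a , a·x≡1 = (false ∷ a) , a·x≡1

nz[⊕]≡false⇒≡ : (x y : Vec Bool v) → nz (x ⊕ y) ≡ false → x ≡ y
nz[⊕]≡false⇒≡ []          []          _  = refl
nz[⊕]≡false⇒≡ (true  ∷ x) (true  ∷ y) eq = cong (true ∷_) (nz[⊕]≡false⇒≡ x y eq)
nz[⊕]≡false⇒≡ (false ∷ x) (false ∷ y) eq = cong (false ∷_) (nz[⊕]≡false⇒≡ x y eq)

separate : (x y : Vec Bool v) → x ≢ y → ∃ λ a → dot a y ≡ not (dot a x)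
separate x y x≢y with nz (x ⊕ y) in nz≡
... | false = ⊥-elim (x≢y (nz[⊕]≡false⇒≡ x y nz≡))
... | true with nonzero⇒detected (x ⊕ y) nz≡
...   | a , a·x⊕y≡1 = a , flip (dot a x) (dot a y) (trans (sym (dot-⊕ʳ a x y)) a·x⊕y≡1)
  where
  flip : ∀ p q → p xor q ≡ true → q ≡ not p
  flip false q eq = eq
  flip true false _ = refl

Region : ℕ → Set
Region v = Vec Bool v → Bool

_∩_ : Region v → Region v → Region v
(p ∩ q) x = p x ∧ q x

∁ : Region v → Region v
∁ p x = not (p x)

_==_ : Bool → Bool → Bool
b == true  = b
b == false = not b

==-refl : ∀ b → b == b ≡ true
==-refl true  = refl
==-refl false = refl

==-not : ∀ b c → not (b == c) ≡ b == not c
==-not b true  = refl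
==-not b false = not-involutive b

halfspace : Vec Bool v → Bool → Region v
halfspace a c x = dot a x == c

mass : (Vec Bool v → ℕ) → Region v → ℕ
mass g p = ∑ (λ x → if p x then g x else 0)

full : Region v
full _ = true

mass-congˡ : {g h : Vec Bool v → ℕ} (p : Region v) → (∀ x → g x ≡ h x) → mass g p ≡ mass h p
mass-congˡ p g≗h = ∑-cong (λ x → cong (λ y → if p x then y else 0) (g≗h x))

module _ (g : Vec Bool v → ℕ) where

  mass-congʳ : {p q : Region v} → (∀ x → p x ≡ q x) → mass g p ≡ mass g q
  mass-congʳ p≗q = ∑-cong (λ x → cong (λ b → if b then g x else 0) (p≗q x))

  mass-split : (p q : Region v) → mass g p ≡ mass g (p ∩ q) + mass g (p ∩ ∁ q)
  mass-split p q = trans (∑-cong (λ x → split (p x) (q x) (g x))) (∑-+ _ _)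
    where
    split : ∀ b c y → (if b then y else 0) ≡ (if b ∧ c then y else 0) + (if b ∧ not c then y else 0)
    split true  true  y = sym (+-identityʳ y)
    split true  false y = refl
    split false c     y = refl

  mass≤∑ : (p : Region v) → mass g p ≤ ∑ g
  mass≤∑ p = ∑-mono bound
    where
    bound : ∀ x → (if p x then g x else 0) ≤ g x
    bound x with p x
    ... | true  = ≤-refl
    ... | false = z≤n

  term≤mass : (p : Region v) (x : Vec Bool v) → p x ≡ true → g x ≤ mass g p
  term≤mass p x px =
    subst (_≤ mass g p) (cong (λ b → if b then g x else 0) px) (term≤∑ (λ x → if p x then g x else 0) x)

  mass-pos : (p : Region v) → 0 < mass g p → ∃ λ x → p x ≡ true × 0 < g x
  mass-pos p 0<mass with ∑-pos _ 0<mass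
  ... | x , 0<term with p x in px
  ...   | true = x , px , 0<term

  mass-dot+mass-∁dot : (a : Vec Bool v) → mass g (dot a) + mass g (halfspace a false) ≡ ∑ g
  mass-dot+mass-∁dot a = sym (mass-split full (dot a))

mass-+ : (g h : Vec Bool v → ℕ) (p : Region v) → mass (λ x → g x + h x) p ≡ mass g p + mass h p
mass-+ g h p = trans (∑-cong (λ x → distrib (p x) (g x) (h x))) (∑-+ _ _)
  where
  distrib : ∀ b y z → (if b then y + z else 0) ≡ (if b then y else 0) + (if b then z else 0)
  distrib true  y z = refl
  distrib false y z = refl

mass-*ˡ : (k : ℕ) (g : Vec Bool v → ℕ) (p : Region v) → mass (λ x → k * g x) p ≡ k * mass g p
mass-*ˡ k g p = trans (∑-cong (λ x → distrib (p x) (g x))) (∑-*ˡ k _)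
  where
  distrib : ∀ b y → (if b then k * y else 0) ≡ k * (if b then y else 0)
  distrib true  y = refl
  distrib false y = sym (*-zeroʳ k)

detectors : Vec Bool v → ℕ
detectors x = ∑ (λ a → if dot a x then 1 else 0)

2*detectors≡2^v : (x : Vec Bool v) → nz x ≡ true → 2 * detectors x ≡ 2 ^ v
2*detectors≡2^v {suc v} (false ∷ x) nz≡ rewrite ∑-split (λ a → if dot a (false ∷ x) then 1 else 0) =
  trans (cong (2 *_) (cong (detectors x +_) (sym (+-identityʳ (detectors x)))))
        (cong (2 *_) (2*detectors≡2^v x nz≡))
2*detectors≡2^v {suc v} (true ∷ x) _ rewrite ∑-split (λ a → if dot a (true ∷ x) then 1 else 0) =
  cong (2 *_) (trans (sym (∑-+ _ _)) (trans (∑-cong (λ a → one-side (dot a x))) (∑-const v)))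
  where
  one-side : ∀ b → (if b then 1 else 0) + (if not b then 1 else 0) ≡ 1
  one-side true  = refl
  one-side false = refl

∑-mass-dot : (g : Vec Bool v → ℕ) → (∀ x → nz x ≡ false → g x ≡ 0) →
             2 * ∑ (λ a → mass g (dot a)) ≡ 2 ^ v * ∑ g
∑-mass-dot {v} g g0 = begin
  2 * ∑ (λ a → mass g (dot a))                       ≡⟨ cong (2 *_) (∑-swap (λ a x → if dot a x then g x else 0)) ⟩
  2 * ∑ (λ x → ∑ (λ a → if dot a x then g x else 0)) ≡⟨ cong (2 *_) (∑-cong inner) ⟩
  2 * ∑ (λ x → g x * detectors x)                     ≡⟨ sym (∑-*ˡ 2 _) ⟩
  ∑ (λ x → 2 * (g x * detectors x))                   ≡⟨ ∑-cong doubled ⟩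
  ∑ (λ x → 2 ^ v * g x)                               ≡⟨ ∑-*ˡ (2 ^ v) g ⟩
  2 ^ v * ∑ g                                         ∎
  where
  open ≡-Reasoning
  as-product : ∀ b y → (if b then y else 0) ≡ y * (if b then 1 else 0)
  as-product true  y = sym (*-identityʳ y)
  as-product false y = sym (*-zeroʳ y)
  inner : ∀ x → ∑ (λ a → if dot a x then g x else 0) ≡ g x * detectors x
  inner x = trans (∑-cong (λ a → as-product (dot a x) (g x))) (∑-*ˡ (g x) _)
  doubled : ∀ x → 2 * (g x * detectors x) ≡ 2 ^ v * g x
  doubled x with nz x in nz≡
  ... | true = begin
    2 * (g x * detectors x) ≡⟨ *-comm 2 (g x * detectors x) ⟩
    g x * detectors x * 2   ≡⟨ *-assoc (g x) (detectors x) 2 ⟩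
    g x * (detectors x * 2) ≡⟨ cong (g x *_) (trans (*-comm (detectors x) 2) (2*detectors≡2^v x nz≡)) ⟩
    g x * 2 ^ v             ≡⟨ *-comm (g x) _ ⟩
    2 ^ v * g x             ∎
  ... | false rewrite g0 x nz≡ = sym (*-zeroʳ (2 ^ v))

mass-dot-pair : (g : Vec Bool v → ℕ) (a b : Vec Bool v) →
                mass g (dot a) + mass g (dot b) ≡ mass g (dot (a ⊕ b)) + 2 * mass g (dot a ∩ dot b)
mass-dot-pair g a b = begin
  mass g (dot a) + mass g (dot b)                                      ≡⟨ ∑-+ _ _ ⟨
  ∑ (λ x → (if dot a x then g x else 0) + (if dot b x then g x else 0)) ≡⟨ ∑-cong pointwise ⟩
  ∑ (λ x → (if dot (a ⊕ b) x then g x else 0) + 2 * (if dot a x ∧ dot b x then g x else 0))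
                                                                       ≡⟨ ∑-+ _ _ ⟩
  mass g (dot (a ⊕ b)) + ∑ (λ x → 2 * (if dot a x ∧ dot b x then g x else 0))
                                                                       ≡⟨ cong (mass g (dot (a ⊕ b)) +_) (∑-*ˡ 2 _) ⟩
  mass g (dot (a ⊕ b)) + 2 * mass g (dot a ∩ dot b)                    ∎
  where
  open ≡-Reasoning
  split : ∀ p q y → (if p then y else 0) + (if q then y else 0) ≡ (if p xor q then y else 0) + 2 * (if p ∧ q then y else 0)
  split true  true  y = cong (y +_) (sym (+-identityʳ y))
  split true  false y = refl
  split false true  y = sym (+-identityʳ y)
  split false false y = refl
  pointwise : ∀ x → (if dot a x then g x else 0) + (if dot b x then g x else 0)
                  ≡ (if dot (a ⊕ b) x then g x else 0) + 2 * (if dot a x ∧ dot b x then g x else 0)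
  pointwise x rewrite dot-⊕ˡ a b x = split (dot a x) (dot b x) (g x)

2∣4 : 2 ∣ 4
2∣4 = divides 2 refl

even-pos⇒≥2 : ∀ {n} → 2 ∣ n → 0 < n → 2 ≤ n
even-pos⇒≥2 {suc zero} (divides (suc q) ()) _
even-pos⇒≥2 {suc (suc n)} _ _ = s≤s (s≤s z≤n)

pos<2⇒≡1 : ∀ {n} → 0 < n → n < 2 → n ≡ 1
pos<2⇒≡1 (s≤s z≤n) (s≤s (s≤s z≤n)) = refl

n≡n%2+2*[n/2] : ∀ n → n ≡ n % 2 + 2 * (n / 2)
n≡n%2+2*[n/2] n = trans (m≡m%n+[m/n]*n n 2) (cong (n % 2 +_) (*-comm (n / 2) 2))

module OddPoints (m : Vec Bool v → ℕ) (2∣∑m : 2 ∣ ∑ m) (4∣mass-dot : ∀ a → 4 ∣ mass m (dot a)) where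

  odd : Vec Bool v → ℕ
  odd x = m x % 2

  half : Vec Bool v → ℕ
  half x = m x / 2

  odd≡1 : ∀ x → 0 < odd x → odd x ≡ 1
  odd≡1 x 0<odd = pos<2⇒≡1 0<odd (m%n<n (m x) 2)

  mass-odd+half : (p : Region v) → mass m p ≡ mass odd p + 2 * mass half p
  mass-odd+half p = begin
    mass m p                               ≡⟨ mass-congˡ p (λ x → n≡n%2+2*[n/2] (m x)) ⟩
    mass (λ x → odd x + 2 * half x) p      ≡⟨ mass-+ odd (λ x → 2 * half x) p ⟩
    mass odd p + mass (λ x → 2 * half x) p ≡⟨ cong (mass odd p +_) (mass-*ˡ 2 half p) ⟩
    mass odd p + 2 * mass half p           ∎
    where open ≡-Reasoning

  even-mass⇒even-odd : (p : Region v) → 2 ∣ mass m p → 2 ∣ mass odd p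
  even-mass⇒even-odd p 2∣mass =
    ∣m+n∣m⇒∣n (subst (2 ∣_) (trans (mass-odd+half p) (+-comm (mass odd p) _)) 2∣mass) (m∣m*n (mass half p))

  even-complement : (p q : Region v) → 2 ∣ mass m p → 2 ∣ mass m (p ∩ q) → 2 ∣ mass m (p ∩ ∁ q)
  even-complement p q 2∣p 2∣p∩q = ∣m+n∣m⇒∣n (subst (2 ∣_) (mass-split m p q) 2∣p) 2∣p∩q

  even-halfspace : ∀ a c → 2 ∣ mass m (halfspace a c)
  even-halfspace a true  = ∣-trans 2∣4 (4∣mass-dot a)
  even-halfspace a false = even-complement full (dot a) 2∣∑m (∣-trans 2∣4 (4∣mass-dot a))

  even-dot∩dot : ∀ a b → 2 ∣ mass m (dot a ∩ dot b)
  even-dot∩dot a b = *-cancelˡ-∣ 2 (∣m+n∣m⇒∣n 4∣sum (4∣mass-dot (a ⊕ b)))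
    where
    4∣sum : 4 ∣ mass m (dot (a ⊕ b)) + 2 * mass m (dot a ∩ dot b)
    4∣sum = subst (4 ∣_) (mass-dot-pair m a b) (∣m∣n⇒∣m+n (4∣mass-dot a) (4∣mass-dot b))

  even-cell : ∀ a c b d → 2 ∣ mass m (halfspace a c ∩ halfspace b d)
  even-cell a true  b true  = even-dot∩dot a b
  even-cell a true  b false = even-complement (dot a) (dot b) (even-halfspace a true) (even-dot∩dot a b)
  even-cell a false b true  = subst (2 ∣_) (mass-congʳ m (λ x → ∧-comm (dot b x) (not (dot a x))))
    (even-complement (dot b) (dot a) (even-halfspace b true) (even-dot∩dot b a))
  even-cell a false b false = even-complement (∁ (dot a)) (dot b) (even-halfspace a false) (even-cell a false b true)

  another-odd : (p : Region v) → 2 ∣ mass odd p → ∀ P → p P ≡ true → odd P ≡ 1 →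
                ∃ λ Q → Q ≢ P × p Q ≡ true × odd Q ≡ 1
  another-odd p 2∣odd P pP oddP with mass-pos odd (p ∩ ∁ (beq P)) rest-pos
    where
    at-P : mass odd (p ∩ beq P) ≡ 1
    at-P = trans (∑-δ P _ off-P) (trans (cong (λ b → if b ∧ beq P P then odd P else 0) pP)
                                         (trans (cong (λ b → if b then odd P else 0) (beq-refl P)) oddP))
      where
      off-P : ∀ x → beq P x ≡ false → (if p x ∧ beq P x then odd x else 0) ≡ 0
      off-P x eq rewrite eq | ∧-zeroʳ (p x) = refl
    rest-pos : 0 < mass odd (p ∩ ∁ (beq P))
    rest-pos = +-cancelˡ-≤ 1 1 _ (subst (2 ≤_) (trans (mass-split odd p (beq P)) (cong (_+ mass odd (p ∩ ∁ (beq P))) at-P))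
                 (even-pos⇒≥2 2∣odd (subst (_≤ mass odd p) oddP (term≤mass odd p P pP))))
  ... | Q , Q∈p∖P , 0<oddQ with p Q in pQ | beq P Q in P≠Q
  ...   | true | false = Q , (λ Q≡P → beq≡false⇒≢ P Q P≠Q (sym Q≡P)) , pQ , odd≡1 Q 0<oddQ

  OddBound : Region v → ℕ → Set
  OddBound R k = ∀ P → R P ≡ true → odd P ≡ 1 → k ≤ mass odd R

  -- Two odd points of R are separated by some functional b, and each side of b gets one of them.
  odd-bound-doubles : (R : Region v) (k : ℕ) → 2 ∣ mass odd R →
                      (∀ b d → OddBound (R ∩ halfspace b d) k) → OddBound R (2 * k)
  odd-bound-doubles R k 2∣odd cells P RP oddP with another-odd R 2∣odd P RP oddP
  ... | Q , Q≢P , RQ , oddQ with separate P Q (λ P≡Q → Q≢P (sym P≡Q))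
  ...   | b , b·Q≡¬b·P = begin
    2 * k                                                            ≡⟨ cong (k +_) (+-identityʳ k) ⟩
    k + k                                                            ≤⟨ +-mono-≤ (cells b d P P∈cell oddP) (cells b (not d) Q Q∈cell oddQ) ⟩
    mass odd (R ∩ halfspace b d) + mass odd (R ∩ halfspace b (not d)) ≡⟨ sym split ⟩
    mass odd R                                                       ∎
    where
    open ≤-Reasoning
    d = dot b P
    P∈cell : R P ∧ (dot b P == d) ≡ true
    P∈cell rewrite RP = ==-refl d
    Q∈cell : R Q ∧ (dot b Q == not d) ≡ true
    Q∈cell rewrite RQ | b·Q≡¬b·P = ==-refl (not d)
    split : mass odd R ≡ mass odd (R ∩ halfspace b d) + mass odd (R ∩ halfspace b (not d))
    split = trans (mass-split odd R (halfspace b d)) (cong (mass odd (R ∩ halfspace b d) +_)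
                  (mass-congʳ odd (λ x → cong (R x ∧_) (==-not (dot b x) d))))

  halfspace-odd≥4 : ∀ a c → OddBound (halfspace a c) 4
  halfspace-odd≥4 a c = odd-bound-doubles (halfspace a c) 2 (even-mass⇒even-odd _ (even-halfspace a c)) cell-bound
    where
    cell-bound : ∀ b d → OddBound (halfspace a c ∩ halfspace b d) 2
    cell-bound b d P inP oddP =
      even-pos⇒≥2 (even-mass⇒even-odd cell (even-cell a c b d)) (subst (_≤ mass odd cell) oddP (term≤mass odd cell P inP))
      where
      cell = halfspace a c ∩ halfspace b d

  odd≥8 : OddBound full 8
  odd≥8 = odd-bound-doubles full 4 (even-mass⇒even-odd full 2∣∑m) halfspace-odd≥4

multiple-of-4≤10 : ∀ {w} → 4 ∣ w → w ≤ 10 → w ≡ 0 ⊎ w ≡ 4 ⊎ w ≡ 8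
multiple-of-4≤10 (divides 0 refl) _ = inj₁ refl
multiple-of-4≤10 (divides 1 refl) _ = inj₂ (inj₁ refl)
multiple-of-4≤10 (divides 2 refl) _ = inj₂ (inj₂ refl)
multiple-of-4≤10 (divides (suc (suc (suc q))) refl) (s≤s (s≤s (s≤s (s≤s (s≤s (s≤s (s≤s (s≤s (s≤s (s≤s ()))))))))))

odd-count-of-ten : ∀ o h → o + 2 * h ≡ 10 → 8 ≤ o → h ≡ 0 ⊎ (h ≡ 1 × o ≡ 8)
odd-count-of-ten o zero          _  _   = inj₁ refl
odd-count-of-ten o (suc zero)    eq _   = inj₂ (refl , +-cancelʳ-≡ 2 o 8 eq)
odd-count-of-ten o (suc (suc h)) eq 8≤o = ⊥-elim (12≰10 (subst (12 ≤_) eq (+-mono-≤ 8≤o (*-monoʳ-≤ 2 (s≤s (s≤s (z≤n {h})))))))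
  where
  12≰10 : 12 ≤ 10 → ⊥
  12≰10 (s≤s (s≤s (s≤s (s≤s (s≤s (s≤s (s≤s (s≤s (s≤s (s≤s ()))))))))))

module WeightTen (m : Vec Bool v → ℕ) (m-zero : ∀ x → nz x ≡ false → m x ≡ 0)
                 (∑m≡10 : ∑ m ≡ 10) (4∣mass-dot : ∀ a → 4 ∣ mass m (dot a)) where

  open OddPoints m (subst (2 ∣_) (sym ∑m≡10) (divides 5 refl)) 4∣mass-dot

  mass-dot∈048 : ∀ a → mass m (dot a) ≡ 0 ⊎ mass m (dot a) ≡ 4 ⊎ mass m (dot a) ≡ 8
  mass-dot∈048 a = multiple-of-4≤10 (4∣mass-dot a) (subst (mass m (dot a) ≤_) ∑m≡10 (mass≤∑ m (dot a)))

  no-halfspace-with-two-odd : ∀ a c → mass odd (halfspace a c) ≢ 2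
  no-halfspace-with-two-odd a c two with mass-pos odd (halfspace a c) (subst (0 <_) (sym two) (s≤s z≤n))
  ... | P , inP , 0<oddP = 4≰2 (subst (4 ≤_) two (halfspace-odd≥4 a c P inP (odd≡1 P 0<oddP)))
    where
    4≰2 : 4 ≤ 2 → ⊥
    4≰2 (s≤s (s≤s ()))

  mass≡odd-mass : mass half full ≡ 0 → ∀ p → mass m p ≡ mass odd p
  mass≡odd-mass H≡0 p = begin
    mass m p                     ≡⟨ mass-odd+half p ⟩
    mass odd p + 2 * mass half p ≡⟨ cong (λ h → mass odd p + 2 * h) (n≤0⇒n≡0 (subst (mass half p ≤_) H≡0 (mass≤∑ half p))) ⟩
    mass odd p + 0               ≡⟨ +-identityʳ _ ⟩
    mass odd p                   ∎
    where open ≡-Reasoning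

  mass-dot≤4 : mass half full ≡ 0 → ∀ a → mass m (dot a) ≤ 4
  mass-dot≤4 H≡0 a with mass-dot∈048 a
  ... | inj₁ W≡0        = subst (_≤ 4) (sym W≡0) z≤n
  ... | inj₂ (inj₁ W≡4) = ≤-reflexive W≡4
  ... | inj₂ (inj₂ W≡8) = ⊥-elim (no-halfspace-with-two-odd a false (+-cancelˡ-≡ 8 _ _ (begin
    8 + mass odd (halfspace a false)            ≡⟨ cong₂ _+_ W≡8 (mass≡odd-mass H≡0 (halfspace a false)) ⟨
    mass m (dot a) + mass m (halfspace a false) ≡⟨ mass-dot+mass-∁dot m a ⟩
    ∑ m                                         ≡⟨ ∑m≡10 ⟩
    10                                          ∎)))
    where open ≡-Reasoning

  half-mass≢0 : mass half full ≢ 0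
  half-mass≢0 H≡0 = 10≰8 (*-cancelˡ-≤ (2 ^ v) {{m^n≢0 2 v}} (begin
    2 ^ v * 10                   ≡⟨ cong (2 ^ v *_) ∑m≡10 ⟨
    2 ^ v * ∑ m                  ≡⟨ ∑-mass-dot m m-zero ⟨
    2 * ∑ (λ a → mass m (dot a)) ≤⟨ *-monoʳ-≤ 2 (∑-mono (mass-dot≤4 H≡0)) ⟩
    2 * ∑ (λ _ → 4)              ≡⟨ cong (2 *_) (trans (∑-*ˡ 4 (λ _ → 1)) (cong (4 *_) (∑-const v))) ⟩
    2 * (4 * 2 ^ v)              ≡⟨ trans (sym (*-assoc 2 4 (2 ^ v))) (*-comm 8 (2 ^ v)) ⟩
    2 ^ v * 8                    ∎))
    where
    open ≤-Reasoning
    10≰8 : 10 ≤ 8 → ⊥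
    10≰8 (s≤s (s≤s (s≤s (s≤s (s≤s (s≤s (s≤s (s≤s ()))))))))

  no-functional-with-odd+2 : mass odd full ≡ 8 → ∀ k → mass m (dot k) ≢ mass odd (dot k) + 2
  no-functional-with-odd+2 O≡8 k W≡O+2 with mass-dot∈048 k
  ... | inj₁ W≡0        = m+1+n≢0 (mass odd (dot k)) (trans (sym W≡O+2) W≡0)
  ... | inj₂ (inj₁ W≡4) = no-halfspace-with-two-odd k true (+-cancelʳ-≡ 2 _ _ (trans (sym W≡O+2) W≡4))
  ... | inj₂ (inj₂ W≡8) = no-halfspace-with-two-odd k false (+-cancelˡ-≡ 6 _ _ (begin
    6 + mass odd (halfspace k false)                ≡⟨ cong (_+ mass odd (halfspace k false)) (+-cancelʳ-≡ 2 _ _ (trans (sym W≡O+2) W≡8)) ⟨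
    mass odd (dot k) + mass odd (halfspace k false) ≡⟨ mass-dot+mass-∁dot odd k ⟩
    mass odd full                                   ≡⟨ O≡8 ⟩
    8                                               ∎))
    where open ≡-Reasoning

  half-mass≢1 : mass odd full ≡ 8 → mass half full ≢ 1
  half-mass≢1 O≡8 H≡1 with mass-pos half full (subst (0 <_) (sym H≡1) (s≤s z≤n))
  ... | e , _ , 0<half-e with nz e in nz≡
  ...   | false with () ← subst (λ y → 0 < y / 2) (m-zero e nz≡) 0<half-e
  ...   | true with nonzero⇒detected e nz≡
  ...     | k , k·e≡1 = no-functional-with-odd+2 O≡8 k (trans (mass-odd+half (dot k)) (cong (λ h → mass odd (dot k) + 2 * h) half-k≡1))
    where
    half-k≡1 : mass half (dot k) ≡ 1
    half-k≡1 = ≤-antisym (subst (mass half (dot k) ≤_) H≡1 (mass≤∑ half (dot k)))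
                         (≤-trans 0<half-e (term≤mass half (dot k) e k·e≡1))

  no-odd-point : ∀ x → 0 < odd x → ⊥
  no-odd-point x 0<odd =
    [ half-mass≢0 , (λ (H≡1 , O≡8) → half-mass≢1 O≡8 H≡1) ]′
      (odd-count-of-ten (mass odd full) (mass half full) (trans (sym (mass-odd+half full)) ∑m≡10)
                        (odd≥8 x refl (odd≡1 x 0<odd)))

  multiplicities-even : ∀ x → m x % 2 ≡ 0
  multiplicities-even x = n≤0⇒n≡0 (≮⇒≥ (no-odd-point x))

𝟏 : Vec Bool n
𝟏 = replicate _ true

weight : Vec Bool n → ℕ
weight []      = 0
weight (b ∷ c) = (if b then 1 else 0) + weight c

weight≤length : (c : Vec Bool n) → weight c ≤ n
weight≤length []          = z≤n
weight≤length (true  ∷ c) = s≤s (weight≤length c)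
weight≤length (false ∷ c) = m≤n⇒m≤1+n (weight≤length c)

weight-insertAt : (c : Vec Bool n) (i : Fin (suc n)) → weight (insertAt c i false) ≡ weight c
weight-insertAt c       zero    = refl
weight-insertAt (b ∷ c) (suc i) = cong ((if b then 1 else 0) +_) (weight-insertAt c i)

weight-complement : (c : Vec Bool n) → weight (c ⊕ 𝟏) + weight c ≡ n
weight-complement []          = refl
weight-complement (true  ∷ c) = trans (+-suc (weight (c ⊕ 𝟏)) (weight c)) (cong suc (weight-complement c))
weight-complement (false ∷ c) = cong suc (weight-complement c)

nonzero⇒weight>0 : (c : Vec Bool n) → T (nz c) → 0 < weight c
nonzero⇒weight>0 (true  ∷ c) _    = s≤s z≤n
nonzero⇒weight>0 (false ∷ c) nz-c = nonzero⇒weight>0 c nz-c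

⊕-interchange : (a b c d : Vec Bool v) → (a ⊕ b) ⊕ (c ⊕ d) ≡ (a ⊕ c) ⊕ (b ⊕ d)
⊕-interchange []      []      []      []      = refl
⊕-interchange (p ∷ a) (q ∷ b) (r ∷ c) (s ∷ d) = cong₂ _∷_ (xor-interchange p q r s) (⊕-interchange a b c d)

⊕-self : (x : Vec Bool v) → x ⊕ x ≡ 𝟎
⊕-self []      = refl
⊕-self (p ∷ x) = cong₂ _∷_ (xor-same p) (⊕-self x)

scale : Bool → Vec Bool v → Vec Bool v
scale b x = if b then x else 𝟎

scale-xor : ∀ b c (x : Vec Bool v) → scale (b xor c) x ≡ scale b x ⊕ scale c x
scale-xor true  true  x = sym (⊕-self x)
scale-xor true  false x = sym (⊕-identityʳ x)
scale-xor false true  x = sym (⊕-identityˡ x)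
scale-xor false false x = sym (⊕-identityˡ 𝟎)

lincomb-⊕ : (c d : Vec Bool n) (xs : Vec (Vec Bool v) n) → lincomb (c ⊕ d) xs ≡ lincomb c xs ⊕ lincomb d xs
lincomb-⊕ []      []      []       = sym (⊕-identityˡ 𝟎)
lincomb-⊕ (b ∷ c) (b′ ∷ d) (x ∷ xs) rewrite scale-xor b b′ x | lincomb-⊕ c d xs =
  ⊕-interchange (scale b x) (scale b′ x) (lincomb c xs) (lincomb d xs)

lincomb-removeAt : (c : Vec Bool n) (xs : Vec (Vec Bool v) (suc n)) (i : Fin (suc n)) →
                   lincomb c (removeAt xs i) ≡ lincomb (insertAt c i false) xs
lincomb-removeAt c       (x ∷ xs) zero    = sym (⊕-identityˡ (lincomb c xs))
lincomb-removeAt (b ∷ c) (x ∷ y ∷ xs) (suc i) = cong (scale b x ⊕_) (lincomb-removeAt c (y ∷ xs) i)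

vecs-removeAt : (B : Vec (Point v) (suc n)) (i : Fin (suc n)) → vecs (removeAt B i) ≡ removeAt (vecs B) i
vecs-removeAt (P ∷ B)     zero    = refl
vecs-removeAt (P ∷ Q ∷ B) (suc i) = cong (vec P ∷_) (vecs-removeAt (Q ∷ B) i)

lincomb-weight≡0 : (c : Vec Bool n) (xs : Vec (Vec Bool v) n) → weight c ≡ 0 → lincomb c xs ≡ 𝟎
lincomb-weight≡0 []          []       _  = refl
lincomb-weight≡0 (false ∷ c) (x ∷ xs) w0 = trans (⊕-identityˡ (lincomb c xs)) (lincomb-weight≡0 c xs w0)

lincomb-weight≡1 : (c : Vec Bool n) (xs : Vec (Vec Bool v) n) → weight c ≡ 1 → lincomb c xs ∈ xs
lincomb-weight≡1 (false ∷ c) (x ∷ xs) w1 rewrite ⊕-identityˡ (lincomb c xs) = there (lincomb-weight≡1 c xs w1)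
lincomb-weight≡1 (true  ∷ c) (x ∷ xs) w1
  rewrite lincomb-weight≡0 c xs (suc-injective w1) | ⊕-identityʳ x = here refl

Nonzero : Vec Bool v → Set
Nonzero x = T (nz x)

vecs-nonzero : (B : Vec (Point v) n) → All Nonzero (vecs B)
vecs-nonzero []      = []
vecs-nonzero (P ∷ B) = nonzero P ∷ vecs-nonzero B

lincomb-light : (c : Vec Bool n) (xs : Vec (Vec Bool v) n) → Unique xs → All Nonzero xs →
                0 < weight c → weight c ≤ 2 → Nonzero (lincomb c xs)
lincomb-light (false ∷ c) (x ∷ xs) (_ ∷ uniq) (_ ∷ nzs) 0<w w≤2 rewrite ⊕-identityˡ (lincomb c xs) =
  lincomb-light c xs uniq nzs 0<w w≤2
lincomb-light (true ∷ c) (x ∷ xs) (x∉xs ∷ _) (nz-x ∷ _) _ (s≤s w≤1) with weight c in w≡ | w≤1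
... | zero        | _      rewrite lincomb-weight≡0 c xs w≡ | ⊕-identityʳ x = nz-x
... | suc (suc _) | s≤s ()
... | suc zero    | _ with nz (x ⊕ lincomb c xs) in nz≡
...   | true  = tt
...   | false = ⊥-elim (All.lookup x∉xs (lincomb-weight≡1 c xs w≡) (nz[⊕]≡false⇒≡ x (lincomb c xs) nz≡))

complement-weight-bounds : ∀ {wc wd} → wd + wc ≡ n → n ≤ 5 → wc < n → 3 ≤ wc → 0 < wd × wd ≤ 2
complement-weight-bounds {n} {wc} {wd} sum≡ n≤5 wc<n 3≤wc =
  +-cancelʳ-< wc 0 wd (subst (wc <_) (sym sum≡) wc<n) ,
  +-cancelʳ-≤ 3 wd 2 (≤-trans (subst (wd + 3 ≤_) sum≡ (+-monoʳ-≤ wd 3≤wc)) n≤5)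

-- Either c or c ⊕ 𝟏, which has the same combination by the zero sum, has weight at most 2.
proper-lincomb-nonzero : (xs : Vec (Vec Bool v) n) → n ≤ 5 → Unique xs → All Nonzero xs → lincomb 𝟏 xs ≡ 𝟎 →
                         (c : Vec Bool n) → 0 < weight c → weight c < n → Nonzero (lincomb c xs)
proper-lincomb-nonzero xs n≤5 uniq nzs zero-sum c 0<w w<n with weight c ≤? 2
... | yes w≤2 = lincomb-light c xs uniq nzs 0<w w≤2
... | no  w≰2 = subst Nonzero same-lincomb (lincomb-light (c ⊕ 𝟏) xs uniq nzs 0<w′ w′≤2)
  where
  bounds = complement-weight-bounds (weight-complement c) n≤5 w<n (≰⇒> w≰2)
  0<w′ = proj₁ bounds
  w′≤2 = proj₂ bounds
  same-lincomb : lincomb (c ⊕ 𝟏) xs ≡ lincomb c xs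
  same-lincomb = trans (lincomb-⊕ c 𝟏 xs) (trans (cong (lincomb c xs ⊕_) zero-sum) (⊕-identityʳ (lincomb c xs)))

zero-sum⇒projectiveBase : (B : Vec (Point v) (suc n)) → suc n ≤ 5 → Unique (vecs B) →
                          nz (lincomb 𝟏 (vecs B)) ≡ false → ProjectiveBase B
zero-sum⇒projectiveBase B n<5 uniq zero-sum i c nz-c =
  subst Nonzero (sym (trans (cong (lincomb c) (vecs-removeAt B i)) (lincomb-removeAt c (vecs B) i)))
    (proper-lincomb-nonzero (vecs B) n<5 uniq (vecs-nonzero B) (nz≡false⇒≡𝟎 _ zero-sum) c′
       (subst (0 <_) (sym (weight-insertAt c i)) (nonzero⇒weight>0 c nz-c))
       (s≤s (subst (_≤ _) (sym (weight-insertAt c i)) (weight≤length c))))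
  where
  c′ = insertAt c i false

occurrences : Vec (Point v) n → Vec Bool v → ℕ
occurrences []      x = 0
occurrences (Q ∷ B) x = (if beq (vec Q) x then 1 else 0) + occurrences B x

remove : Vec Bool v → (Vec Bool v → ℕ) → Vec Bool v → ℕ
remove y h x = if beq y x then 0 else h x

remove-≤ : (y : Vec Bool v) (h : Vec Bool v → ℕ) (x : Vec Bool v) → remove y h x ≤ h x
remove-≤ y h x with beq y x
... | true  = z≤n
... | false = ≤-refl

remove-restore : (y : Vec Bool v) (h : Vec Bool v → ℕ) → h y ≡ 1 →
                 ∀ x → h x ≡ (if beq y x then 1 else 0) + remove y h x
remove-restore y h hy≡1 x with beq y x in eq
... | true  = trans (cong h (sym (beq-sound y x eq))) hy≡1
... | false = refl

∑-remove : (y : Vec Bool v) (h : Vec Bool v → ℕ) → ∑ h ≡ h y + ∑ (remove y h)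
∑-remove y h = begin
  ∑ h                                                            ≡⟨ ∑-cong (λ x → split (beq y x) (h x)) ⟩
  ∑ (λ x → (if beq y x then h x else 0) + remove y h x)          ≡⟨ ∑-+ _ _ ⟩
  ∑ (λ x → if beq y x then h x else 0) + ∑ (remove y h)          ≡⟨ cong (_+ ∑ (remove y h)) (∑-δ y _ off-y) ⟩
  (if beq y y then h y else 0) + ∑ (remove y h)                  ≡⟨ cong (λ b → (if b then h y else 0) + ∑ (remove y h)) (beq-refl y) ⟩
  h y + ∑ (remove y h)                                           ∎
  where
  open ≡-Reasoning
  split : ∀ b z → z ≡ (if b then z else 0) + (if b then 0 else z)
  split true  z = sym (+-identityʳ z)
  split false z = refl
  off-y : ∀ x → beq y x ≡ false → (if beq y x then h x else 0) ≡ 0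
  off-y x eq rewrite eq = refl

enumerate : ∀ n (h : Vec Bool v → ℕ) → (∀ x → nz x ≡ false → h x ≡ 0) → (∀ x → h x ≤ 1) → ∑ h ≡ n →
            ∃ λ (B : Vec (Point v) n) → ∀ x → h x ≡ occurrences B x
enumerate zero    h h0 h≤1 ∑h≡0 = [] , λ x → n≤0⇒n≡0 (subst (h x ≤_) ∑h≡0 (term≤∑ h x))
enumerate (suc n) h h0 h≤1 ∑h≡1+n with ∑-pos h (subst (0 <_) (sym ∑h≡1+n) (s≤s z≤n))
... | y , 0<hy with nz y in nz≡
...   | false = ⊥-elim (<-irrefl (sym (h0 y nz≡)) 0<hy)
...   | true with ≤-antisym (h≤1 y) 0<hy
...     | hy≡1 with enumerate n (remove y h) (λ x nz≡ → n≤0⇒n≡0 (subst (remove y h x ≤_) (h0 x nz≡) (remove-≤ y h x)))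
                              (λ x → ≤-trans (remove-≤ y h x) (h≤1 x))
                              (suc-injective (trans (cong (_+ ∑ (remove y h)) (sym hy≡1)) (trans (sym (∑-remove y h)) ∑h≡1+n)))
...       | B , remove≡occ =
  point y (subst T (sym nz≡) tt) ∷ B ,
  λ x → trans (remove-restore y h hy≡1 x) (cong ((if beq y x then 1 else 0) +_) (remove≡occ x))

occurrences≡0⇒∉ : (B : Vec (Point v) n) (x : Vec Bool v) → occurrences B x ≡ 0 → All (λ y → x ≢ y) (vecs B)
occurrences≡0⇒∉ []      x _   = []
occurrences≡0⇒∉ (Q ∷ B) x occ≡0 with beq (vec Q) x in eq
... | true with () ← occ≡0
... | false = (λ x≡Q → beq≡false⇒≢ (vec Q) x eq (sym x≡Q)) ∷ occurrences≡0⇒∉ B x occ≡0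

∉⇒occurrences≡0 : (B : Vec (Point v) n) (x : Vec Bool v) → All (λ y → x ≢ y) (vecs B) → occurrences B x ≡ 0
∉⇒occurrences≡0 []      x []            = refl
∉⇒occurrences≡0 (Q ∷ B) x (x≢Q ∷ x∉B) with beq (vec Q) x in eq
... | true  = ⊥-elim (x≢Q (sym (beq-sound (vec Q) x eq)))
... | false = ∉⇒occurrences≡0 B x x∉B

occurrences≤1⇒unique : (B : Vec (Point v) n) → (∀ x → occurrences B x ≤ 1) → Unique (vecs B)
occurrences≤1⇒unique []      _     = []
occurrences≤1⇒unique (Q ∷ B) occ≤1 =
  occurrences≡0⇒∉ B (vec Q) (n≤0⇒n≡0 (≤-pred (subst (λ b → (if b then 1 else 0) + occurrences B (vec Q) ≤ 1) (beq-refl (vec Q)) (occ≤1 (vec Q)))))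
  ∷ occurrences≤1⇒unique B (λ x → ≤-trans (m≤n+m _ _) (occ≤1 x))

χ≡occurrences : (B : Vec (Point v) n) → Unique (vecs B) → ∀ P → χ B P ≡ occurrences B (vec P)
χ≡occurrences []      _              P = refl
χ≡occurrences (Q ∷ B) (Q∉B ∷ uniq) P with beq (vec Q) (vec P) in eq
... | true  = cong suc (sym (∉⇒occurrences≡0 B (vec P) (subst (λ x → All (λ y → x ≢ y) (vecs B)) (beq-sound (vec Q) (vec P) eq) Q∉B)))
... | false = χ≡occurrences B uniq P

mass-occurrences : (B : Vec (Point v) n) (p : Region v) → mass (occurrences B) p ≡ weight (map p (vecs B))
mass-occurrences []      p = ∑-zero (λ x → if-eta (p x))
mass-occurrences (Q ∷ B) p =
  trans (mass-+ (λ x → if beq (vec Q) x then 1 else 0) (occurrences B) p)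
        (cong₂ _+_ (trans (∑-δ (vec Q) _ off-Q) (at-Q (p (vec Q)) (beq-refl (vec Q)))) (mass-occurrences B p))
  where
  off-Q : ∀ x → beq (vec Q) x ≡ false → (if p x then (if beq (vec Q) x then 1 else 0) else 0) ≡ 0
  off-Q x eq rewrite eq with p x
  ... | true  = refl
  ... | false = refl
  at-Q : ∀ b {c} → c ≡ true → (if b then (if c then 1 else 0) else 0) ≡ (if b then 1 else 0)
  at-Q b refl = refl

dot-lincomb : (a : Vec Bool v) (c : Vec Bool n) (xs : Vec (Vec Bool v) n) →
              dot a (lincomb c xs) ≡ dot c (map (dot a) xs)
dot-lincomb a []      []       = dot-𝟎ʳ a
dot-lincomb a (b ∷ c) (x ∷ xs) =
  trans (dot-⊕ʳ a (scale b x) (lincomb c xs)) (cong₂ _xor_ (dot-scale b) (dot-lincomb a c xs))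
  where
  dot-scale : ∀ b → dot a (scale b x) ≡ b ∧ dot a x
  dot-scale true  = refl
  dot-scale false = dot-𝟎ʳ a

weight-parity : (b : Vec Bool n) → ∃ λ k → weight b ≡ (if dot 𝟏 b then 1 else 0) + 2 * k
weight-parity []          = 0 , refl
weight-parity (false ∷ b) = weight-parity b
weight-parity (true ∷ b) with weight-parity b
... | k , w≡ with dot 𝟏 b
...   | false = k , cong suc w≡
...   | true  = suc k , trans (cong suc w≡) (cong suc (sym (+-suc k (k + 0))))

even-weight⇒dot𝟏≡false : (b : Vec Bool n) → 2 ∣ weight b → dot 𝟏 b ≡ false
even-weight⇒dot𝟏≡false b 2∣w with weight-parity b
... | k , w≡ with dot 𝟏 b
...   | false = refl
...   | true with () ← ∣1⇒≡1 (∣m+n∣m⇒∣n (subst (2 ∣_) (trans w≡ (+-comm 1 (2 * k))) 2∣w) (m∣m*n k))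

even-patterns⇒zero-sum : (xs : Vec (Vec Bool v) n) → (∀ a → 2 ∣ weight (map (dot a) xs)) → nz (lincomb 𝟏 xs) ≡ false
even-patterns⇒zero-sum xs even with nz (lincomb 𝟏 xs) in nz≡
... | false = refl
... | true with nonzero⇒detected (lincomb 𝟏 xs) nz≡
...   | a , detected with () ← trans (sym detected) (trans (dot-lincomb a 𝟏 xs) (even-weight⇒dot𝟏≡false (map (dot a) xs) (even a)))

mod-sum : ∀ {d m w} → m ≡ m + w [mod d ] → d ∣ w
mod-sum {d} {m} {w} d∣m-[m+w] =
  subst (d ∣_) (trans (cong ℤ.∣_∣ ([+m]-[+n]≡m⊖n m (m + w))) (trans (∣⊖∣-≤ (m≤m+n m w)) (m+n∸m≡n m w))) d∣m-[m+w]

ext-point : (M : Multiset v) (P : Point v) → ext M (vec P) ≡ M P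
ext-point M (point x t) = at (nz x) (λ t → M (point x t)) t
  where
  at : ∀ b (f : T b → ℕ) (t : T b) → ext' b f ≡ f t
  at true f tt = refl

ext-zero : (M : Multiset v) (x : Vec Bool v) → nz x ≡ false → ext M x ≡ 0
ext-zero M x nz≡ = at (nz x) nz≡ (λ t → M (point x t))
  where
  at : ∀ b → b ≡ false → (f : T b → ℕ) → ext' b f ≡ 0
  at false refl f = refl

ext-support : (M : Multiset v) (x : Vec Bool v) → 0 < ext M x → T (nz x)
ext-support M x = at (nz x) (λ t → M (point x t))
  where
  at : ∀ b (f : T b → ℕ) → 0 < ext' b f → T b
  at true _ _ = tt

opaque
  unfolding ∑

  card≡∑ : (M : Multiset v) → card M ≡ ∑ (ext M)
  card≡∑ M = refl

  hypMult≡∑ : (M : Multiset v) (a : Point v) → hypMult M a ≡ ∑ (λ x → if dot (vec a) x then 0 else ext M x)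
  hypMult≡∑ M a = refl

hypMult+mass-dot : (M : Multiset v) (a : Point v) → hypMult M a + mass (ext M) (dot (vec a)) ≡ card M
hypMult+mass-dot M a = begin
  hypMult M a + mass (ext M) (dot (vec a))                        ≡⟨ cong (_+ mass (ext M) (dot (vec a))) (trans (hypMult≡∑ M a) (∑-cong λ x → flip (dot (vec a) x))) ⟩
  mass (ext M) (halfspace (vec a) false) + mass (ext M) (dot (vec a)) ≡⟨ +-comm (mass (ext M) (halfspace (vec a) false)) _ ⟩
  mass (ext M) (dot (vec a)) + mass (ext M) (halfspace (vec a) false) ≡⟨ mass-dot+mass-∁dot (ext M) (vec a) ⟩
  ∑ (ext M)                                                          ≡⟨ sym (card≡∑ M) ⟩
  card M ∎
  where
  open ≡-Reasoning
  flip : ∀ b {y} → (if b then 0 else y) ≡ (if not b then y else 0)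
  flip true  = refl
  flip false = refl

divisible⇒4∣mass-dot : (M : Multiset v) → Divisible 4 M → ∀ a → 4 ∣ mass (ext M) (dot a)
divisible⇒4∣mass-dot M div a with nz a in nz≡
... | false rewrite nz≡false⇒≡𝟎 a nz≡ = subst (4 ∣_) (sym (∑-zero (λ x → cong (λ b → if b then ext M x else 0) (dot-𝟎ˡ x)))) (divides 0 refl)
... | true  = mod-sum {4} {hypMult M P} (subst (λ c → hypMult M P ≡ c [mod 4 ]) (sym (hypMult+mass-dot M P)) (div P))
  where
  P = point a (subst T (sym nz≡) tt)

heavy-point-or-light : (M : Multiset v) → (∃ λ P → 4 ≤ M P) ⊎ (∀ x → ext M x ≤ 3)
heavy-point-or-light M with ∑ (λ x → ext M x ∸ 3) in ∑≡
... | zero  = inj₂ (λ x → m∸n≡0⇒m≤n (n≤0⇒n≡0 (subst (ext M x ∸ 3 ≤_) ∑≡ (term≤∑ (λ x → ext M x ∸ 3) x))))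
... | suc _ with ∑-pos (λ x → ext M x ∸ 3) (subst (0 <_) (sym ∑≡) (s≤s z≤n))
...   | x , 0<excess = inj₁ (P , subst (4 ≤_) (ext-point M P) 4≤mx)
  where
  4≤mx : 4 ≤ ext M x
  4≤mx = m∸n≢0⇒n<m (λ eq → <-irrefl (sym eq) 0<excess)
  P = point x (ext-support M x (≤-trans (s≤s z≤n) 4≤mx))

halving : (m : Vec Bool v → ℕ) → (∀ x → m x % 2 ≡ 0) → ∀ x → m x ≡ 2 * (m x / 2)
halving m even x = trans (n≡n%2+2*[n/2] (m x)) (cong (_+ 2 * (m x / 2)) (even x))

indicator⇒projectiveBase : (h : Vec Bool v → ℕ) → (∀ x → nz x ≡ false → h x ≡ 0) → (∀ x → h x ≤ 1) →
                           ∑ h ≡ suc n → suc n ≤ 5 → (∀ a → 2 ∣ mass h (dot a)) →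
                           ∃ λ (B : Vec (Point v) (suc n)) → ProjectiveBase B × (∀ P → h (vec P) ≡ χ B P)
indicator⇒projectiveBase {n = n} h h0 h≤1 ∑h≡1+n n<5 2∣mass-dot with enumerate (suc n) h h0 h≤1 ∑h≡1+n
... | B , h≡occ = B , zero-sum⇒projectiveBase B n<5 unique zero-sum , λ P → trans (h≡occ (vec P)) (sym (χ≡occurrences B unique P))
  where
  unique = occurrences≤1⇒unique B (λ x → subst (_≤ 1) (h≡occ x) (h≤1 x))
  zero-sum = even-patterns⇒zero-sum (vecs B)
               (λ a → subst (2 ∣_) (trans (mass-congˡ (dot a) h≡occ) (mass-occurrences B (dot a))) (2∣mass-dot a))

twice-projective-base : (M : Multiset v) → ∑ (ext M) ≡ 10 → (∀ a → 4 ∣ mass (ext M) (dot a)) →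
                        (∀ x → ext M x % 2 ≡ 0) → (∀ x → ext M x ≤ 3) →
                        ∃ λ (B : Vec (Point v) 5) → ProjectiveBase B × (∀ P → M P ≡ 2 * χ B P)
twice-projective-base {v} M ∑m≡10 4∣mass-dot even m≤3
  with indicator⇒projectiveBase half half-zero (λ x → /-monoˡ-≤ 2 (m≤3 x)) ∑half≡5 ≤-refl 2∣mass-dot
  where
  m = ext M
  half : Vec Bool v → ℕ
  half x = m x / 2
  m≡2*half = halving m even
  half-zero : ∀ x → nz x ≡ false → half x ≡ 0
  half-zero x nz≡ = cong (_/ 2) (ext-zero M x nz≡)
  ∑half≡5 : ∑ half ≡ 5
  ∑half≡5 = *-cancelˡ-≡ (∑ half) 5 2 (trans (sym (∑-*ˡ 2 half)) (trans (sym (∑-cong m≡2*half)) ∑m≡10))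
  2∣mass-dot : ∀ a → 2 ∣ mass half (dot a)
  2∣mass-dot a = *-cancelˡ-∣ 2 (subst (4 ∣_) (trans (mass-congˡ (dot a) m≡2*half) (mass-*ˡ 2 half (dot a))) (4∣mass-dot a))
... | B , base , half≡χ = B , base , λ P → trans (sym (ext-point M P)) (trans (halving (ext M) even (vec P)) (cong (2 *_) (half≡χ P)))

proposition19 : (v : ℕ) (M : Multiset v) → Divisible 4 M → card M ≡ 10 →
    (∃ λ (P : Point v) → 4 ≤ M P)
    ⊎ (∃ λ (B : Vec (Point v) 5) → ProjectiveBase B × (∀ P → M P ≡ 2 * χ B P))
proposition19 v M div card≡10 with heavy-point-or-light M
... | inj₁ heavy = inj₁ heavy
... | inj₂ ≤3 = inj₂ (twice-projective-base M ∑≡10 4∣mass-dot (WeightTen.multiplicities-even (ext M) (ext-zero M) ∑≡10 4∣mass-dot) ≤3)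
  where
  ∑≡10 = trans (sym (card≡∑ M)) card≡10
  4∣mass-dot = divisible⇒4∣mass-dot M div
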